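{- Let $G$ be any connected graph with $\mathbf{vsrc}(G)\le k$ and treewidth at most $t-1$. Then $\Delta(G)\le kt$ and $|V(G)|\le (kt)^k$.
   Context: All graphs are finite, simple and undirected. $\Delta(G)$ is the maximum degree of $G$. A very strong rainbow coloring of $G$ is a coloring of $E(G)$ such that for every pair of vertices and every shortest path between them, all edges of that path receive pairwise different colors; $\mathbf{vsrc}(G)$ is the minimum number of colors in such a coloring. -}

module Defs where

open import Data.Nat using (ℕ; zero; suc; _≤_; _+_)
open import Data.Bool using (Bool; true; false)
open import Data.Fin using (Fin; zero; suc; inject₁; fromℕ)
open import Data.Fin.Subset using (Subset; _∈_; ∣_∣)
open import Data.Vec using (tabulate)
open import Data.Product using (Σ; ∃; ∃-syntax; _×_)
open import Data.Empty using (⊥)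
open import Relation.Binary.PropositionalEquality using (_≡_; _≢_)

record Graph (n : ℕ) : Set where
  field
    adj    : Fin n → Fin n → Bool
    sym    : ∀ u v → adj u v ≡ adj v u
    irrefl : ∀ v → adj v v ≡ false
open Graph public

Edge : ∀ {n} → Graph n → Fin n → Fin n → Set
Edge G u v = adj G u v ≡ true

nbhd : ∀ {n} → Graph n → Fin n → Subset n
nbhd G v = tabulate (adj G v)

degree : ∀ {n} → Graph n → Fin n → ℕ
degree G v = ∣ nbhd G v ∣

IsWalk : ∀ {n} → Graph n → (l : ℕ) → (Fin (suc l) → Fin n) → Set
IsWalk G l p = ∀ (i : Fin l) → Edge G (p (inject₁ i)) (p (suc i))

WalkFromTo : ∀ {n} → Graph n → Fin n → Fin n → (l : ℕ) → (Fin (suc l) → Fin n) → Set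
WalkFromTo G u v l p = IsWalk G l p × p zero ≡ u × p (fromℕ l) ≡ v

IsShortestPath : ∀ {n} → Graph n → Fin n → Fin n → (l : ℕ) → (Fin (suc l) → Fin n) → Set
IsShortestPath {n} G u v l p =
  WalkFromTo G u v l p × (∀ (l' : ℕ) (q : Fin (suc l') → Fin n) → WalkFromTo G u v l' q → l ≤ l')

Connected : ∀ {n} → Graph n → Set
Connected {n} G = ∀ (u v : Fin n) → ∃[ l ] ∃[ p ] WalkFromTo G u v l p

-- Edge colourings with (at most) k colours; only values on edges matter.
record EdgeColoring {n} (G : Graph n) (k : ℕ) : Set where
  field
    col     : Fin n → Fin n → Fin k
    col-sym : ∀ u v → col u v ≡ col v u
open EdgeColoring public

Rainbow : ∀ {n} {G : Graph n} {k} → EdgeColoring G k → (l : ℕ) → (Fin (suc l) → Fin n) → Set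
Rainbow c l p = ∀ (i j : Fin l) → i ≢ j →
  col c (p (inject₁ i)) (p (suc i)) ≢ col c (p (inject₁ j)) (p (suc j))

IsVeryStrongRainbow : ∀ {n} {G : Graph n} {k} → EdgeColoring G k → Set
IsVeryStrongRainbow {n} {G} c =
  ∀ (u v : Fin n) (l : ℕ) (p : Fin (suc l) → Fin n) → IsShortestPath G u v l p → Rainbow c l p

vsrc≤ : ∀ {n} → Graph n → ℕ → Set
vsrc≤ G k = Σ (EdgeColoring G k) IsVeryStrongRainbow

IsCycle : ∀ {n} → Graph n → (l : ℕ) → (Fin (suc l) → Fin n) → Set
IsCycle G l p = 3 ≤ l × IsWalk G l p × p zero ≡ p (fromℕ l)
  × (∀ (i j : Fin l) → p (inject₁ i) ≡ p (inject₁ j) → i ≡ j)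

Acyclic : ∀ {n} → Graph n → Set
Acyclic {n} G = ∀ (l : ℕ) (p : Fin (suc l) → Fin n) → IsCycle G l p → ⊥

IsTree : ∀ {m} → Graph m → Set
IsTree T = Connected T × Acyclic T

record TreeDecomposition {n} (G : Graph n) : Set where
  field
    m    : ℕ
    T    : Graph m
    tree : IsTree T
    bag  : Fin m → Subset n
    covers-vertices : ∀ (v : Fin n) → ∃[ x ] v ∈ bag x
    covers-edges    : ∀ (u v : Fin n) → Edge G u v → ∃[ x ] (u ∈ bag x × v ∈ bag x)
    subtree-connected : ∀ (v : Fin n) (x y : Fin m) → v ∈ bag x → v ∈ bag y →
      ∃[ l ] ∃[ p ] (WalkFromTo T x y l p × (∀ i → v ∈ bag (p i)))
open TreeDecomposition public

-- treewidth(G) ≤ t - 1, i.e. G has a tree decomposition with all bags of size ≤ t.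
TreewidthBelow : ∀ {n} → Graph n → ℕ → Set
TreewidthBelow G t = Σ (TreeDecomposition G) λ D → ∀ x → ∣ bag D x ∣ ≤ t

-- If two neighbours u, w of v are joined to v by edges of the same colour, they are adjacent,
-- since otherwise u v w would be a shortest path that is not rainbow. So v together with its
-- neighbours of one colour is a clique; by the Helly property of subtrees of a tree a clique
-- lies inside a single bag, so each colour contributes at most t - 1 neighbours and
-- Δ ≤ k (t - 1). Shortest paths are rainbow and hence of length at most k, so every vertex
-- lies in the ball of radius k around a fixed vertex, which has at most (1 + Δ)^k ≤ (k t)^k
-- vertices.
module Submission where

open import Defs
open import Data.Nat using (ℕ; zero; suc; _≤_; _<_; _+_; _*_; _^_; z≤n; s≤s; _≤′_; _≤?_; ≤′-reflexive; ≤′-step)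
open import Data.Nat.Properties
  using (≤-trans; ≤-refl; ≤-reflexive; n≤1+n; <-irrefl; ≤-pred; *-monoʳ-≤; ≰⇒>; ≤⇒≤′; ^-monoˡ-≤; *-suc; m≤n+m)
open import Data.Bool using (Bool; true; false; _∨_)
import Data.Bool as Bool
open import Data.Fin using (Fin; zero; suc; toℕ; inject₁; fromℕ; inject≤; punchOut; combine; _≟_)
open import Data.Fin.Properties
  using ( toℕ-inject₁; toℕ-fromℕ; toℕ-injective; toℕ<n; suc-injective; punchOut-injective
        ; inject≤-injective; combine-injective; any?; pigeonhole; <⇒≢)
open import Data.Fin.Subset using (Subset; _∈_; ∣_∣; inside; outside) renaming (⊤ to ⊤ₛ)
open import Data.Fin.Subset.Properties using (p⊆q⇒∣p∣≤∣q∣; ∣⊤∣≡n)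
open import Data.Vec using (tabulate; []; _∷_)
open import Data.Vec.Base using (here; there)
open import Data.Vec.Properties using ([]=⇒lookup; lookup⇒[]=; lookup∘tabulate)
open import Data.List using (List; []; _∷_; allFin; filter)
open import Data.List.Relation.Unary.All using (All; []; _∷_)
open import Data.List.Relation.Unary.All.Properties using (all-filter)
open import Data.List.Relation.Unary.Any using (here; there)
import Data.List.Membership.Propositional as List
open import Data.List.Membership.Propositional.Properties using (∈-allFin; ∈-filter⁺)
open import Data.Product using (Σ; ∃; ∃-syntax; _×_; _,_; proj₁; proj₂; map₂; swap)
open import Data.Sum using (_⊎_; inj₁; inj₂)
open import Data.Unit using (⊤; tt)
open import Data.Empty using (⊥-elim)
open import Relation.Nullary using (¬_; Dec; yes; no)
open import Relation.Nullary.Decidable using (_×-dec_; _⊎-dec_; isYes)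
open import Relation.Unary using (Decidable)
open import Relation.Binary.PropositionalEquality
  using (_≡_; _≢_; refl; trans; cong; subst; subst₂) renaming (sym to ≡-sym)

∈-tabulate⁺ : ∀ {n} (f : Fin n → Bool) {x} → f x ≡ true → x ∈ tabulate f
∈-tabulate⁺ f {x} fx = lookup⇒[]= x (tabulate f) (trans (lookup∘tabulate f x) fx)

∈-tabulate⁻ : ∀ {n} (f : Fin n → Bool) {x} → x ∈ tabulate f → f x ≡ true
∈-tabulate⁻ f {x} x∈ = trans (≡-sym (lookup∘tabulate f x)) ([]=⇒lookup x∈)

injective⇒∣p∣≤ : ∀ {n b} (p : Subset n) (f : ∀ x → x ∈ p → Fin b) →
  (∀ x y x∈p y∈p → f x x∈p ≡ f y y∈p → x ≡ y) → ∣ p ∣ ≤ b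
injective⇒∣p∣≤ [] f inj = z≤n
injective⇒∣p∣≤ (outside ∷ p) f inj =
  injective⇒∣p∣≤ p (λ x x∈p → f (suc x) (there x∈p))
    (λ x y x∈p y∈p eq → suc-injective (inj (suc x) (suc y) (there x∈p) (there y∈p) eq))
injective⇒∣p∣≤ {b = zero}  (inside ∷ p) f inj with () ← f zero here
injective⇒∣p∣≤ {b = suc b} (inside ∷ p) f inj = s≤s (injective⇒∣p∣≤ p f′ inj′)
  where
  f₀≢f : ∀ x (x∈p : x ∈ p) → f zero here ≢ f (suc x) (there x∈p)
  f₀≢f x x∈p eq with () ← inj zero (suc x) here (there x∈p) eq
  f′ : ∀ x → x ∈ p → Fin b
  f′ x x∈p = punchOut (f₀≢f x x∈p)
  inj′ : ∀ x y x∈p y∈p → f′ x x∈p ≡ f′ y y∈p → x ≡ y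
  inj′ x y x∈p y∈p eq = suc-injective (inj (suc x) (suc y) (there x∈p) (there y∈p)
    (punchOut-injective (f₀≢f x x∈p) (f₀≢f y y∈p) eq))

position : ∀ {n} (p : Subset n) {x} → x ∈ p → Fin ∣ p ∣
position (inside ∷ p)  here        = zero
position (inside ∷ p)  (there x∈p) = suc (position p x∈p)
position (outside ∷ p) (there x∈p) = position p x∈p

position-injective : ∀ {n} (p : Subset n) {x y} (x∈p : x ∈ p) (y∈p : y ∈ p) →
  position p x∈p ≡ position p y∈p → x ≡ y
position-injective (inside ∷ p)  here        here        _  = refl
position-injective (inside ∷ p)  (there x∈p) (there y∈p) eq =
  cong suc (position-injective p x∈p y∈p (suc-injective eq))
position-injective (outside ∷ p) (there x∈p) (there y∈p) eq =
  cong suc (position-injective p x∈p y∈p eq)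

full⇒n≤∣p∣ : ∀ {n} (p : Subset n) → (∀ x → x ∈ p) → n ≤ ∣ p ∣
full⇒n≤∣p∣ {n} p all∈ = ≤-trans (≤-reflexive (≡-sym (∣⊤∣≡n n))) (p⊆q⇒∣p∣≤∣q∣ {p = ⊤ₛ} (λ {x} _ → all∈ x))

module Walks {m : ℕ} (G : Graph m) where

  edge-sym : ∀ {x y} → Edge G x y → Edge G y x
  edge-sym {x} {y} e = trans (Graph.sym G y x) e

  edge-irrefl : ∀ {x} → ¬ Edge G x x
  edge-irrefl {x} e with () ← trans (≡-sym e) (irrefl G x)

  infixr 5 _∷⟨_⟩_

  data Walk (S : Fin m → Set) : Fin m → Fin m → ℕ → Set where
    [_]    : ∀ {x} → S x → Walk S x x 0
    _∷⟨_⟩_ : ∀ {x y z l} → S x → Edge G x y → Walk S y z l → Walk S x z (suc l)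

  Everywhere : Fin m → Set
  Everywhere _ = ⊤

  module _ {S : Fin m → Set} where

    vertexAt : ∀ {x y l} → Walk S x y l → ℕ → Fin m
    vertexAt ([_] {x} _)        _       = x
    vertexAt (_∷⟨_⟩_ {x} _ _ w) zero    = x
    vertexAt (_ ∷⟨ _ ⟩ w)       (suc i) = vertexAt w i

    vertexAt-zero : ∀ {x y l} (w : Walk S x y l) → vertexAt w 0 ≡ x
    vertexAt-zero [ _ ]        = refl
    vertexAt-zero (_ ∷⟨ _ ⟩ _) = refl

    vertexAt-length : ∀ {x y l} (w : Walk S x y l) → vertexAt w l ≡ y
    vertexAt-length [ _ ]        = refl
    vertexAt-length (_ ∷⟨ _ ⟩ w) = vertexAt-length w

    vertexAt-edge : ∀ {x y l} (w : Walk S x y l) i → i < l →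
      Edge G (vertexAt w i) (vertexAt w (suc i))
    vertexAt-edge (_ ∷⟨ e ⟩ w) zero    _         = subst (Edge G _) (≡-sym (vertexAt-zero w)) e
    vertexAt-edge (_ ∷⟨ _ ⟩ w) (suc i) (s≤s i<l) = vertexAt-edge w i i<l

    source∈ : ∀ {x y l} → Walk S x y l → S x
    source∈ [ s ]        = s
    source∈ (s ∷⟨ _ ⟩ _) = s

    target∈ : ∀ {x y l} → Walk S x y l → S y
    target∈ [ s ]        = s
    target∈ (_ ∷⟨ _ ⟩ w) = target∈ w

    second : ∀ {x y l} → Walk S x y (suc l) → Fin m
    second (_∷⟨_⟩_ {y = y} _ _ _) = y

    penultimate : ∀ {x y l} → Walk S x y (suc l) → Fin m
    penultimate (_∷⟨_⟩_ {x} _ _ [ _ ])     = x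
    penultimate (_ ∷⟨ _ ⟩ w@(_ ∷⟨ _ ⟩ _)) = penultimate w

    NonBacktracking : ∀ {x y l} → Walk S x y l → Set
    NonBacktracking [ _ ]            = ⊤
    NonBacktracking (_ ∷⟨ _ ⟩ [ _ ]) = ⊤
    NonBacktracking (_∷⟨_⟩_ {x} _ _ w@(_∷⟨_⟩_ {y = z} _ _ _)) = x ≢ z × NonBacktracking w

    nonBacktracking-tail : ∀ {x y z l} {s : S x} {e : Edge G x y} (w : Walk S y z l) →
      NonBacktracking (s ∷⟨ e ⟩ w) → NonBacktracking w
    nonBacktracking-tail [ _ ]        _        = tt
    nonBacktracking-tail (_ ∷⟨ _ ⟩ _) (_ , nb) = nb

    dropFirst : ∀ {x y z l} (w : Walk S x y (suc l)) → second w ≡ z → Walk S z y l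
    dropFirst (_ ∷⟨ _ ⟩ w) refl = w

    dropFirst-nonBacktracking : ∀ {x y z l} (w : Walk S x y (suc l)) (eq : second w ≡ z) →
      NonBacktracking w → NonBacktracking (dropFirst w eq)
    dropFirst-nonBacktracking (_ ∷⟨ _ ⟩ w) refl = nonBacktracking-tail w

    dropLast : ∀ {x y l} (w : Walk S x y (suc l)) → Walk S x (penultimate w) l
    dropLast (s ∷⟨ _ ⟩ [ _ ])             = [ s ]
    dropLast (s ∷⟨ e ⟩ w@(_ ∷⟨ _ ⟩ _)) = s ∷⟨ e ⟩ dropLast w

    dropLast-nonBacktracking : ∀ {x y l} (w : Walk S x y (suc l)) →
      NonBacktracking w → NonBacktracking (dropLast w)
    dropLast-nonBacktracking (_ ∷⟨ _ ⟩ [ _ ])                       _          = tt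
    dropLast-nonBacktracking (_ ∷⟨ _ ⟩ (_ ∷⟨ _ ⟩ [ _ ]))             _          = tt
    dropLast-nonBacktracking (_ ∷⟨ _ ⟩ w@(_ ∷⟨ _ ⟩ (_ ∷⟨ _ ⟩ _))) (x≢z , nb) =
      x≢z , dropLast-nonBacktracking w nb

    infixr 5 _++_
    _++_ : ∀ {x y z l l′} → Walk S x y l → Walk S y z l′ → Walk S x z (l + l′)
    [ _ ]        ++ w′ = w′
    (s ∷⟨ e ⟩ w) ++ w′ = s ∷⟨ e ⟩ (w ++ w′)

    ++-nonBacktracking : ∀ {x y z l l′} (w : Walk S x y (suc l)) (w′ : Walk S y z (suc l′)) →
      NonBacktracking w → NonBacktracking w′ → penultimate w ≢ second w′ →
      NonBacktracking (w ++ w′)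
    ++-nonBacktracking (_ ∷⟨ _ ⟩ [ _ ])           (_ ∷⟨ _ ⟩ _) _          nb′ ne = ne , nb′
    ++-nonBacktracking (_ ∷⟨ _ ⟩ w@(_ ∷⟨ _ ⟩ _)) w′           (x≢z , nb) nb′ ne =
      x≢z , ++-nonBacktracking w w′ nb nb′ ne

    snoc : ∀ {x y z l} → Walk S x y l → Edge G y z → S z → Walk S x z (suc l)
    snoc [ s ]        e′ s′ = s ∷⟨ e′ ⟩ [ s′ ]
    snoc (s ∷⟨ e ⟩ w) e′ s′ = s ∷⟨ e ⟩ snoc w e′ s′

    penultimate-snoc : ∀ {x y z l} (w : Walk S x y l) (e : Edge G y z) (s : S z) →
      penultimate (snoc w e s) ≡ y
    penultimate-snoc [ _ ]                    _ _ = refl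
    penultimate-snoc (_ ∷⟨ _ ⟩ [ _ ])         _ _ = refl
    penultimate-snoc (_ ∷⟨ _ ⟩ w@(_ ∷⟨ _ ⟩ _)) e s = penultimate-snoc w e s

    snoc-nonBacktracking : ∀ {x y z l} (w : Walk S x y (suc l)) (e : Edge G y z) (s : S z) →
      NonBacktracking w → penultimate w ≢ z → NonBacktracking (snoc w e s)
    snoc-nonBacktracking (_ ∷⟨ _ ⟩ [ _ ])           _ _ _          ne = ne , tt
    snoc-nonBacktracking (_ ∷⟨ _ ⟩ w@(_ ∷⟨ _ ⟩ _)) e s (x≢z , nb) ne =
      x≢z , snoc-nonBacktracking w e s nb ne

    reverse : ∀ {x y l} → Walk S x y l → Walk S y x l
    reverse [ s ]        = [ s ]
    reverse (s ∷⟨ e ⟩ w) = snoc (reverse w) (edge-sym e) s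

    reverse-nonBacktracking : ∀ {x y l} (w : Walk S x y l) →
      NonBacktracking w → NonBacktracking (reverse w)
    reverse-nonBacktracking [ _ ]            _ = tt
    reverse-nonBacktracking (_ ∷⟨ _ ⟩ [ _ ]) _ = tt
    reverse-nonBacktracking (s ∷⟨ e ⟩ w@(s′ ∷⟨ e′ ⟩ w′)) (x≢z , nb) =
      snoc-nonBacktracking (reverse w) (edge-sym e) s (reverse-nonBacktracking w nb)
        (λ eq → x≢z (≡-sym (trans (≡-sym (penultimate-snoc (reverse w′) (edge-sym e′) s′)) eq)))

    penultimate-reverse : ∀ {x y l} (w : Walk S x y (suc l)) → penultimate (reverse w) ≡ second w
    penultimate-reverse (s ∷⟨ e ⟩ w) = penultimate-snoc (reverse w) (edge-sym e) s

    shorter-or-nonBacktracking : ∀ {x y l} (w : Walk S x y l) →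
      NonBacktracking w ⊎ ∃[ l′ ] (l′ < l × Walk S x y l′)
    shorter-or-nonBacktracking [ _ ]            = inj₁ tt
    shorter-or-nonBacktracking (_ ∷⟨ _ ⟩ [ _ ]) = inj₁ tt
    shorter-or-nonBacktracking (_∷⟨_⟩_ {x} s e w@(_∷⟨_⟩_ {y = z} _ _ w′))
      with shorter-or-nonBacktracking w
    ... | inj₂ (l′ , l′<l , v) = inj₂ (suc l′ , s≤s l′<l , s ∷⟨ e ⟩ v)
    ... | inj₁ nb with x ≟ z
    ...   | yes refl = inj₂ (_ , s≤s (n≤1+n _) , w′)
    ...   | no x≢z   = inj₁ (x≢z , nb)

    nonBacktracking-shortcut : ∀ {x y l} → Walk S x y l → ∃[ l′ ] Σ (Walk S x y l′) NonBacktracking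
    nonBacktracking-shortcut {l = l} = go l ≤-refl
      where
      go : ∀ fuel {x y l} → l ≤ fuel → Walk S x y l → ∃[ l′ ] Σ (Walk S x y l′) NonBacktracking
      go fuel l≤fuel w with shorter-or-nonBacktracking w
      ... | inj₁ nb = _ , w , nb
      go zero       l≤fuel w | inj₂ (_ , l′<l , _) with () ← ≤-trans l′<l l≤fuel
      go (suc fuel) l≤fuel w | inj₂ (_ , l′<l , v) = go fuel (≤-pred (≤-trans l′<l l≤fuel)) v

  map : ∀ {S S′ : Fin m → Set} {x y l} → (∀ {z} → S z → S′ z) → Walk S x y l → Walk S′ x y l
  map f [ s ]        = [ f s ]
  map f (s ∷⟨ e ⟩ w) = f s ∷⟨ e ⟩ map f w

  map-nonBacktracking : ∀ {S S′ : Fin m → Set} {x y l} (f : ∀ {z} → S z → S′ z) (w : Walk S x y l) →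
    NonBacktracking w → NonBacktracking (map f w)
  map-nonBacktracking f [ _ ]                    _          = tt
  map-nonBacktracking f (_ ∷⟨ _ ⟩ [ _ ])         _          = tt
  map-nonBacktracking f (_ ∷⟨ _ ⟩ w@(_ ∷⟨ _ ⟩ _)) (x≢z , nb) = x≢z , map-nonBacktracking f w nb

  penultimate-map : ∀ {S S′ : Fin m → Set} {x y l} (f : ∀ {z} → S z → S′ z) (w : Walk S x y (suc l)) →
    penultimate (map f w) ≡ penultimate w
  penultimate-map f (_ ∷⟨ _ ⟩ [ _ ])           = refl
  penultimate-map f (_ ∷⟨ _ ⟩ w@(_ ∷⟨ _ ⟩ _)) = penultimate-map f w

  forget : ∀ {S : Fin m → Set} {x y l} → Walk S x y l → Walk Everywhere x y l
  forget = map (λ _ → tt)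

  fromWalkFromTo : ∀ {S : Fin m → Set} {x y} l (p : Fin (suc l) → Fin m) →
    WalkFromTo G x y l p → (∀ i → S (p i)) → Walk S x y l
  fromWalkFromTo l p (walk , refl , refl) p∈S = go l p walk p∈S
    where
    go : ∀ {S : Fin m → Set} l (p : Fin (suc l) → Fin m) → IsWalk G l p → (∀ i → S (p i)) →
      Walk S (p zero) (p (fromℕ l)) l
    go zero    p walk p∈S = [ p∈S zero ]
    go (suc l) p walk p∈S =
      p∈S zero ∷⟨ walk zero ⟩ go l (λ i → p (suc i)) (λ i → walk (suc i)) (λ i → p∈S (suc i))

  toFunction : ∀ {S : Fin m → Set} {x y l} → Walk S x y l → Fin (suc l) → Fin m
  toFunction w i = vertexAt w (toℕ i)

  toFunction-walkFromTo : ∀ {S : Fin m → Set} {x y l} (w : Walk S x y l) →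
    WalkFromTo G x y l (toFunction w)
  toFunction-walkFromTo {l = l} w = walk , vertexAt-zero w , last
    where
    walk : IsWalk G l (toFunction w)
    walk i rewrite toℕ-inject₁ i = vertexAt-edge w (toℕ i) (toℕ<n i)
    last : vertexAt w (toℕ (fromℕ l)) ≡ _
    last rewrite toℕ-fromℕ l = vertexAt-length w

module AcyclicWalks {m : ℕ} (T : Graph m) (acyclic : Acyclic T) where
  open Walks T

  nonBacktracking-injective : ∀ {S x y l} (w : Walk S x y l) → NonBacktracking w →
    ∀ i j → i ≤ l → j ≤ l → vertexAt w i ≡ vertexAt w j → i ≡ j
  nonBacktracking-noReturn : ∀ {S x y z l} (s : S x) (e : Edge T x y) (w : Walk S y z l) →
    NonBacktracking (s ∷⟨ e ⟩ w) → ∀ j → j ≤ l → x ≢ vertexAt w j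

  nonBacktracking-injective [ _ ]        nb zero    zero    _         _         _  = refl
  nonBacktracking-injective (_ ∷⟨ _ ⟩ _) nb zero    zero    _         _         _  = refl
  nonBacktracking-injective (s ∷⟨ e ⟩ w) nb (suc i) (suc j) (s≤s i≤l) (s≤s j≤l) eq =
    cong suc (nonBacktracking-injective w (nonBacktracking-tail w nb) i j i≤l j≤l eq)
  nonBacktracking-injective (s ∷⟨ e ⟩ w) nb zero    (suc j) _         (s≤s j≤l) eq =
    ⊥-elim (nonBacktracking-noReturn s e w nb j j≤l eq)
  nonBacktracking-injective (s ∷⟨ e ⟩ w) nb (suc i) zero    (s≤s i≤l) _         eq =
    ⊥-elim (nonBacktracking-noReturn s e w nb i i≤l (≡-sym eq))

  nonBacktracking-noReturn s e w nb zero _ eq =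
    edge-irrefl (subst (Edge T _) (≡-sym (trans eq (vertexAt-zero w))) e)
  nonBacktracking-noReturn s e (_ ∷⟨ _ ⟩ w′) (x≢z , _) (suc zero) _ eq = x≢z (trans eq (vertexAt-zero w′))
  -- For j ≥ 2 the walk from x back to vertexAt w j = x is a cycle: its other vertices are
  -- distinct by injectivity on w.
  nonBacktracking-noReturn s e w nb (suc (suc j′)) j≤l eq =
    acyclic (suc j) cycle (s≤s (s≤s (s≤s z≤n)) , isWalk , closed , distinct)
    where
    j : ℕ
    j = suc (suc j′)
    V : ℕ → Fin _
    V = vertexAt (s ∷⟨ e ⟩ w)
    cycle : Fin (suc (suc j)) → Fin _
    cycle i = V (toℕ i)
    isWalk : IsWalk T (suc j) cycle
    isWalk i rewrite toℕ-inject₁ i = vertexAt-edge (s ∷⟨ e ⟩ w) (toℕ i) (≤-trans (toℕ<n i) (s≤s j≤l))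
    closed : cycle zero ≡ cycle (fromℕ (suc j))
    closed rewrite toℕ-fromℕ j′ = eq
    injective-tail : ∀ a b → a ≤ j → b ≤ j → vertexAt w a ≡ vertexAt w b → a ≡ b
    injective-tail a b a≤j b≤j = nonBacktracking-injective w (nonBacktracking-tail w nb) a b
      (≤-trans a≤j j≤l) (≤-trans b≤j j≤l)
    V-injective : ∀ a b → a ≤ j → b ≤ j → V a ≡ V b → a ≡ b
    V-injective zero    zero    _         _         _  = refl
    V-injective (suc a) (suc b) (s≤s a<j) (s≤s b<j) eq′ =
      cong suc (injective-tail a b (≤-trans a<j (n≤1+n _)) (≤-trans b<j (n≤1+n _)) eq′)
    V-injective zero    (suc b) _ (s≤s b<j) eq′ = ⊥-elim (<-irrefl
      (injective-tail b j (≤-trans b<j (n≤1+n _)) ≤-refl (trans (≡-sym eq′) eq)) (s≤s b<j))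
    V-injective (suc a) zero    (s≤s a<j) _ eq′ = ⊥-elim (<-irrefl
      (injective-tail a j (≤-trans a<j (n≤1+n _)) ≤-refl (trans eq′ eq)) (s≤s a<j))
    distinct : ∀ (i i′ : Fin (suc j)) → cycle (inject₁ i) ≡ cycle (inject₁ i′) → i ≡ i′
    distinct i i′ eq′ rewrite toℕ-inject₁ i | toℕ-inject₁ i′ =
      toℕ-injective (V-injective (toℕ i) (toℕ i′) (≤-pred (toℕ<n i)) (≤-pred (toℕ<n i′)) eq′)

  closed⇒¬nonBacktracking : ∀ {S x l} (w : Walk S x x (suc l)) → ¬ NonBacktracking w
  closed⇒¬nonBacktracking {l = l} w nb
    with () ← nonBacktracking-injective w nb 0 (suc l) z≤n ≤-refl
                (trans (vertexAt-zero w) (≡-sym (vertexAt-length w)))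

  -- Two non-backtracking x–y walks coincide, so the first one also lies in the region of the second.
  nonBacktracking-∩ : ∀ {S S′ x y l l′} (w : Walk S x y l) (w′ : Walk S′ x y l′) →
    NonBacktracking w → NonBacktracking w′ → Walk (λ z → S z × S′ z) x y l
  nonBacktracking-∩ [ s ] w′ _ _ = [ s , source∈ w′ ]
  nonBacktracking-∩ w@(_ ∷⟨ _ ⟩ _) [ _ ] nb _ = ⊥-elim (closed⇒¬nonBacktracking w nb)
  nonBacktracking-∩ w@(_∷⟨_⟩_ {y = y} s e v) w′@(_∷⟨_⟩_ {y = y′} s′ _ v′) nb nb′ with y ≟ y′
  ... | yes refl =
    (s , s′) ∷⟨ e ⟩ nonBacktracking-∩ v v′ (nonBacktracking-tail v nb) (nonBacktracking-tail v′ nb′)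
  ... | no y≢y′ = ⊥-elim (closed⇒¬nonBacktracking (forget (reverse w) ++ forget w′)
        (++-nonBacktracking (forget (reverse w)) (forget w′)
          (map-nonBacktracking _ (reverse w) (reverse-nonBacktracking w nb))
          (map-nonBacktracking _ w′ nb′)
          (λ eq → y≢y′ (trans (≡-sym (trans (penultimate-map _ (reverse w)) (penultimate-reverse w))) eq))))

  Subtree : (Fin m → Set) → Set
  Subtree S = ∀ {x y} → S x → S y → ∃[ l ] Walk S x y l

  subtree-∩ : ∀ {S S′} → Subtree S → Subtree S′ → Subtree (λ z → S z × S′ z)
  subtree-∩ tS tS′ (sx , s′x) (sy , s′y)
    with _ , w , nb ← nonBacktracking-shortcut (proj₂ (tS sx sy))
       | _ , w′ , nb′ ← nonBacktracking-shortcut (proj₂ (tS′ s′x s′y))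
    = _ , nonBacktracking-∩ w w′ nb nb′

  -- Walking b → c in A, c → a in B and a → b in C: cancelling backtracks at c and a shrinks the
  -- triangle, and if no backtrack is left the closed walk would contradict acyclicity.
  helly₃ : ∀ {A B C} → Subtree A → Subtree B → Subtree C →
    (∃ λ z → A z × B z) → (∃ λ z → B z × C z) → (∃ λ z → C z × A z) → ∃ λ z → A z × B z × C z
  helly₃ {A} {B} {C} tA tB tC (c , ac , bc) (a , ba , ca) (b , cb , ab)
    with _ , w₁ , nb₁ ← nonBacktracking-shortcut (proj₂ (tA ab ac))
       | _ , w₂ , nb₂ ← nonBacktracking-shortcut (proj₂ (tB bc ba))
       | _ , w₃ , nb₃ ← nonBacktracking-shortcut (proj₂ (tC ca cb))
    = triangle w₁ w₂ w₃ nb₁ nb₂ nb₃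
    where
    triangle : ∀ {a b c l₁ l₂ l₃} (w₁ : Walk A b c l₁) (w₂ : Walk B c a l₂) (w₃ : Walk C a b l₃) →
      NonBacktracking w₁ → NonBacktracking w₂ → NonBacktracking w₃ → ∃ λ z → A z × B z × C z
    triangle [ sb ] w₂ w₃ _ _ _ = _ , sb , source∈ w₂ , target∈ w₃
    triangle w₁ [ sc ] w₃ _ _ _ = _ , target∈ w₁ , sc , source∈ w₃
    triangle w₁ w₂ [ sa ] _ _ _ = _ , source∈ w₁ , target∈ w₂ , sa
    triangle w₁@(_ ∷⟨ _ ⟩ _) w₂@(_ ∷⟨ _ ⟩ _) w₃@(_ ∷⟨ _ ⟩ _) nb₁ nb₂ nb₃
      with penultimate w₁ ≟ second w₂ | penultimate w₂ ≟ second w₃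
    ... | yes eq | _ = triangle (dropLast w₁) (dropFirst w₂ (≡-sym eq)) w₃
          (dropLast-nonBacktracking w₁ nb₁) (dropFirst-nonBacktracking w₂ (≡-sym eq) nb₂) nb₃
    ... | no _ | yes eq = triangle w₁ (dropLast w₂) (dropFirst w₃ (≡-sym eq))
          nb₁ (dropLast-nonBacktracking w₂ nb₂) (dropFirst-nonBacktracking w₃ (≡-sym eq) nb₃)
    ... | no ne₁ | no ne₂ = ⊥-elim (closed⇒¬nonBacktracking (forget w₁ ++ forget w₂ ++ forget w₃)
          (++-nonBacktracking (forget w₁) (forget w₂ ++ forget w₃) (map-nonBacktracking _ w₁ nb₁)
            (++-nonBacktracking (forget w₂) (forget w₃) (map-nonBacktracking _ w₂ nb₂)
              (map-nonBacktracking _ w₃ nb₃) (λ eq → ne₂ (trans (≡-sym (penultimate-map _ w₂)) eq)))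
            (λ eq → ne₁ (trans (≡-sym (penultimate-map _ w₁)) eq))))

module Decomposition {n : ℕ} {G : Graph n} (D : TreeDecomposition G) where
  open Walks (T D) using (fromWalkFromTo)
  open AcyclicWalks (T D) (proj₂ (tree D))

  InAllBags : List (Fin n) → Fin (m D) → Set
  InAllBags []      x = ⊤
  InAllBags (u ∷ L) x = u ∈ bag D x × InAllBags L x

  InAllBags-∈ : ∀ {L x u} → InAllBags L x → u List.∈ L → u ∈ bag D x
  InAllBags-∈ (u∈bag , _) (here refl) = u∈bag
  InAllBags-∈ (_ , L⊆bag) (there u∈L) = InAllBags-∈ L⊆bag u∈L

  bags-subtree : ∀ u → Subtree (λ x → u ∈ bag D x)
  bags-subtree u {x} {y} u∈x u∈y
    with l , p , walk , u∈p ← subtree-connected D u x y u∈x u∈y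
    = l , fromWalkFromTo l p walk u∈p

  InAllBags-subtree : ∀ L → Subtree (InAllBags L)
  InAllBags-subtree []      {x} {y} _ _ with l , p , walk ← proj₁ (tree D) x y
    = l , fromWalkFromTo l p walk (λ _ → tt)
  InAllBags-subtree (u ∷ L) = subtree-∩ (bags-subtree u) (InAllBags-subtree L)

  module _ {P : Fin n → Set} (clique : ∀ {u v} → P u → P v → u ≡ v ⊎ Edge G u v) where

    InAllBags-meets-bag : ∀ L → All P L → ∀ {u} → P u → ∃ λ x → u ∈ bag D x × InAllBags L x
    InAllBags-meets-bag [] [] {u} _ with x , u∈x ← covers-vertices D u = x , u∈x , tt
    InAllBags-meets-bag (u′ ∷ L) (pu′ ∷ pL) {u} pu =
      helly₃ (bags-subtree u) (bags-subtree u′) (InAllBags-subtree L) bags-meet (IH pu′) (map₂ swap (IH pu))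
      where
      IH = InAllBags-meets-bag L pL
      bags-meet : ∃ λ x → u ∈ bag D x × u′ ∈ bag D x
      bags-meet with clique pu pu′
      ... | inj₁ refl = let (x , u∈x , _) = IH pu in x , u∈x , u∈x
      ... | inj₂ e    = covers-edges D u u′ e

    clique⊆bag : Decidable P → ∀ {v} → P v → ∃ λ x → ∀ u → P u → u ∈ bag D x
    clique⊆bag P? pv
      with x , _ , common ← InAllBags-meets-bag (filter P? (allFin n)) (all-filter P? (allFin n)) pv
      = x , λ u pu → InAllBags-∈ common (∈-filter⁺ P? (∈-allFin u) pu)

module DegreeBound {n k : ℕ} {G : Graph n} (c : EdgeColoring G k) (rainbow : IsVeryStrongRainbow c) where
  open Walks G using (edge-sym; edge-irrefl)

  same-colour-neighbours-adjacent : ∀ {v u w} → Edge G v u → Edge G v w → col c v u ≡ col c v w →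
    u ≡ w ⊎ Edge G u w
  same-colour-neighbours-adjacent {v} {u} {w} vu vw same with u ≟ w | adj G u w Bool.≟ true
  ... | yes u≡w | _      = inj₁ u≡w
  ... | no _    | yes uw = inj₂ uw
  ... | no u≢w  | no ¬uw =
    ⊥-elim (rainbow u w 2 path ((walk , refl , refl) , shortest) zero (suc zero) (λ ())
      (trans (col-sym c u v) same))
    where
    path : Fin 3 → Fin n
    path zero             = u
    path (suc zero)       = v
    path (suc (suc zero)) = w
    walk : IsWalk G 2 path
    walk zero       = edge-sym vu
    walk (suc zero) = vw
    shortest : ∀ l q → WalkFromTo G u w l q → 2 ≤ l
    shortest zero          _ (_ , q₀ , q₀≡w) = ⊥-elim (u≢w (trans (≡-sym q₀) q₀≡w))
    shortest (suc zero)    _ (qw , q₀ , q₁)  = ⊥-elim (¬uw (subst₂ (Edge G) q₀ q₁ (qw zero)))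
    shortest (suc (suc _)) _ _               = s≤s (s≤s z≤n)

  module _ (D : TreeDecomposition G) {t : ℕ} (bag≤ : ∀ x → ∣ bag D x ∣ ≤ suc t) where

    ColourClass : Fin n → Fin k → Fin n → Set
    ColourClass v κ u = u ≡ v ⊎ (Edge G v u × col c v u ≡ κ)

    colourClass? : ∀ v κ → Decidable (ColourClass v κ)
    colourClass? v κ u = (u ≟ v) ⊎-dec ((adj G v u Bool.≟ true) ×-dec (col c v u ≟ κ))

    colourClass-clique : ∀ {v κ u w} → ColourClass v κ u → ColourClass v κ w → u ≡ w ⊎ Edge G u w
    colourClass-clique (inj₁ refl)      (inj₁ refl)      = inj₁ refl
    colourClass-clique (inj₁ refl)      (inj₂ (vw , _))  = inj₂ vw
    colourClass-clique (inj₂ (vu , _))  (inj₁ refl)      = inj₂ (edge-sym vu)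
    colourClass-clique (inj₂ (vu , cu)) (inj₂ (vw , cw)) =
      same-colour-neighbours-adjacent vu vw (trans cu (≡-sym cw))

    module _ (v : Fin n) (κ : Fin k) where

      classBag : ∃ λ x → ∀ u → ColourClass v κ u → u ∈ bag D x
      classBag = Decomposition.clique⊆bag D colourClass-clique (colourClass? v κ) (inj₁ refl)

      slot : ∀ {u} → ColourClass v κ u → Fin (suc t)
      slot {u} p = inject≤ (position (bag D (proj₁ classBag)) (proj₂ classBag u p)) (bag≤ _)

      slot-injective : ∀ {u w} (p : ColourClass v κ u) (q : ColourClass v κ w) → slot p ≡ slot q → u ≡ w
      slot-injective p q eq = position-injective (bag D (proj₁ classBag)) _ _ (inject≤-injective _ _ _ _ eq)

      centre≢neighbour : ∀ {u} (vu : Edge G v u) (cu : col c v u ≡ κ) → slot (inj₁ refl) ≢ slot (inj₂ (vu , cu))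
      centre≢neighbour vu cu eq with refl ← slot-injective (inj₁ refl) (inj₂ (vu , cu)) eq = edge-irrefl vu

      -- v occupies one of the t + 1 slots of its bag, so its κ-neighbours fit into the other t.
      neighbourIndex : ∀ {u} → Edge G v u → col c v u ≡ κ → Fin t
      neighbourIndex vu cu = punchOut (centre≢neighbour vu cu)

    neighbourIndex-injective : ∀ {v u w κ κ′} (vu : Edge G v u) (cu : col c v u ≡ κ)
      (vw : Edge G v w) (cw : col c v w ≡ κ′) → κ ≡ κ′ →
      neighbourIndex v κ vu cu ≡ neighbourIndex v κ′ vw cw → u ≡ w
    neighbourIndex-injective {v} {κ = κ} vu cu vw cw refl eq = slot-injective v κ _ _
      (punchOut-injective (centre≢neighbour v κ vu cu) (centre≢neighbour v κ vw cw) eq)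

    degree≤ : ∀ v → degree G v ≤ k * t
    degree≤ v = injective⇒∣p∣≤ (nbhd G v) code code-injective
      where
      code : ∀ u → u ∈ nbhd G v → Fin (k * t)
      code u u∈ = combine (col c v u) (neighbourIndex v (col c v u) (∈-tabulate⁻ (adj G v) u∈) refl)
      code-injective : ∀ u w u∈ w∈ → code u u∈ ≡ code w w∈ → u ≡ w
      code-injective u w u∈ w∈ eq with same-colour , same-index ← combine-injective _ _ _ _ eq =
        neighbourIndex-injective _ refl _ refl same-colour same-index

rainbow-shortestPath-length≤ : ∀ {n k} {G : Graph n} (c : EdgeColoring G k) → IsVeryStrongRainbow c →
  ∀ {u v} l p → IsShortestPath G u v l p → l ≤ k
rainbow-shortestPath-length≤ {k = k} c rainbow {u} {v} l p shortest with l ≤? k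
... | yes l≤k = l≤k
... | no l≰k with i , j , i<j , same ← pigeonhole (≰⇒> l≰k) (λ i → col c (p (inject₁ i)) (p (suc i)))
  = ⊥-elim (rainbow u v l p shortest i j (<⇒≢ i<j) same)

module Balls {n : ℕ} (G : Graph n) (r : Fin n) where
  open Walks G

  parent? : (R : Fin n → Bool) (w : Fin n) → Dec (∃ λ u → R u ≡ true × Edge G u w)
  parent? R w = any? (λ u → (R u Bool.≟ true) ×-dec (adj G u w Bool.≟ true))

  grow : (Fin n → Bool) → Fin n → Bool
  grow R w = R w ∨ isYes (parent? R w)

  inBall : ℕ → Fin n → Bool
  inBall zero    w = isYes (w ≟ r)
  inBall (suc d) = grow (inBall d)

  ball : ℕ → Subset n
  ball d = tabulate (inBall d)

  inBall-zero : ∀ {w} → inBall 0 w ≡ true → w ≡ r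
  inBall-zero {w} h with w ≟ r
  ... | yes w≡r = w≡r

  inBall-centre : inBall 0 r ≡ true
  inBall-centre with r ≟ r
  ... | yes _  = refl
  ... | no r≢r = ⊥-elim (r≢r refl)

  inBall-neighbour : ∀ d {u w} → inBall d u ≡ true → Edge G u w → inBall (suc d) w ≡ true
  inBall-neighbour d {u} {w} hu e with inBall d w | parent? (inBall d) w
  ... | true  | _       = refl
  ... | false | yes _   = refl
  ... | false | no ¬par = ⊥-elim (¬par (u , hu , e))

  inBall-suc : ∀ d {w} → inBall d w ≡ true → inBall (suc d) w ≡ true
  inBall-suc d {w} h with inBall d w
  inBall-suc d refl | true = refl

  inBall-mono : ∀ {d d′ w} → d ≤ d′ → inBall d w ≡ true → inBall d′ w ≡ true
  inBall-mono d≤d′ = go (≤⇒≤′ d≤d′)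
    where
    go : ∀ {d d′ w} → d ≤′ d′ → inBall d w ≡ true → inBall d′ w ≡ true
    go (≤′-reflexive refl) h = h
    go {d′ = suc d′} (≤′-step d≤′d′) h = inBall-suc d′ (go d≤′d′ h)

  inBall-sound : ∀ d {w} → inBall d w ≡ true → ∃ λ l → l ≤ d × Walk Everywhere r w l
  inBall-sound zero h with refl ← inBall-zero h = 0 , z≤n , [ tt ]
  inBall-sound (suc d) {w} h with inBall d w in hw | parent? (inBall d) w
  ... | true  | _ = let (l , l≤d , walk) = inBall-sound d hw in l , ≤-trans l≤d (n≤1+n d) , walk
  ... | false | yes (u , hu , e) =
    let (l , l≤d , walk) = inBall-sound d hu in suc l , s≤s l≤d , snoc walk e tt

  inBall-complete : ∀ {w} l p → WalkFromTo G r w l p → inBall l w ≡ true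
  inBall-complete l p (walk , p₀≡r , refl) = go l p walk p₀≡r
    where
    go : ∀ l p → IsWalk G l p → p zero ≡ r → inBall l (p (fromℕ l)) ≡ true
    go zero    p walk refl = inBall-centre
    go (suc l) p walk p₀≡r =
      inBall-neighbour l (go l (λ i → p (inject₁ i)) (λ i → walk (inject₁ i)) p₀≡r) (walk (fromℕ l))

  least-radius : ∀ {w} L → inBall L w ≡ true →
    ∃ λ d → inBall d w ≡ true × (∀ {d′} → inBall d′ w ≡ true → d ≤ d′)
  least-radius zero h = zero , h , λ _ → z≤n
  least-radius {w} (suc L) h with inBall L w Bool.≟ true
  ... | yes hL = least-radius L hL
  ... | no ¬hL = suc L , h , minimal
    where
    minimal : ∀ {d′} → inBall d′ w ≡ true → suc L ≤ d′
    minimal {d′} h′ with d′ ≤? L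
    ... | yes d′≤L = ⊥-elim (¬hL (inBall-mono d′≤L h′))
    ... | no d′≰L  = ≰⇒> d′≰L

  shortestPath : ∀ {w} → ∃[ l ] ∃[ p ] WalkFromTo G r w l p → ∃[ l ] ∃[ p ] IsShortestPath G r w l p
  shortestPath (L , p , walk) =
    let (d , hd , minimal) = least-radius L (inBall-complete L p walk)
        (l , l≤d , path)   = inBall-sound d hd
    in l , toFunction path , toFunction-walkFromTo path ,
       λ l′ q walk′ → ≤-trans l≤d (minimal (inBall-complete l′ q walk′))

  module _ {Δ : ℕ} (degree≤ : ∀ v → degree G v ≤ Δ) where

    data Reached (d : ℕ) (w : Fin n) : Set where
      old : w ∈ ball d → Reached d w
      new : ∀ {u} → u ∈ ball d → Edge G u w → Reached d w

    reached : ∀ d {w} → w ∈ ball (suc d) → Reached d w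
    reached d {w} w∈ with inBall d w in hw | parent? (inBall d) w | ∈-tabulate⁻ (inBall (suc d)) w∈
    ... | true  | _                | _ = old (∈-tabulate⁺ (inBall d) hw)
    ... | false | yes (u , hu , e) | _ = new (∈-tabulate⁺ (inBall d) hu) e
    ... | false | no _             | ()

    -- A vertex of the next ball is recorded by its own position in the old ball, or else by
    -- the position of a parent u in the old ball together with its position among u's neighbours.
    tag : ∀ {d w} → Reached d w → Fin (suc Δ)
    tag (old _)       = zero
    tag (new {u} _ e) = suc (inject≤ (position (nbhd G u) (∈-tabulate⁺ (adj G u) e)) (degree≤ u))

    anchor : ∀ {d w} → Reached d w → Fin ∣ ball d ∣
    anchor {d} (old w∈)   = position (ball d) w∈
    anchor {d} (new u∈ _) = position (ball d) u∈

    reached-injective : ∀ {d w w′} (ρ : Reached d w) (ρ′ : Reached d w′) →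
      tag ρ ≡ tag ρ′ → anchor ρ ≡ anchor ρ′ → w ≡ w′
    reached-injective {d} (old w∈) (old w′∈) _ same-anchor =
      position-injective (ball d) w∈ w′∈ same-anchor
    reached-injective {d} (new {u} u∈ e) (new u′∈ e′) same-tag same-anchor
      with refl ← position-injective (ball d) u∈ u′∈ same-anchor
      = position-injective (nbhd G u) _ _ (inject≤-injective _ _ _ _ (suc-injective same-tag))

    encode : ∀ {d w} → Reached d w → Fin (suc Δ * ∣ ball d ∣)
    encode ρ = combine (tag ρ) (anchor ρ)

    encode-injective : ∀ {d w w′} (ρ : Reached d w) (ρ′ : Reached d w′) → encode ρ ≡ encode ρ′ → w ≡ w′
    encode-injective ρ ρ′ eq
      with same-tag , same-anchor ← combine-injective (tag ρ) (anchor ρ) (tag ρ′) (anchor ρ′) eq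
      = reached-injective ρ ρ′ same-tag same-anchor

    ∣ball∣≤ : ∀ d → ∣ ball d ∣ ≤ suc Δ ^ d
    ∣ball∣≤ zero = injective⇒∣p∣≤ (ball 0) (λ _ _ → zero) λ _ _ w∈ w′∈ _ →
      trans (inBall-zero (∈-tabulate⁻ (inBall 0) w∈)) (≡-sym (inBall-zero (∈-tabulate⁻ (inBall 0) w′∈)))
    ∣ball∣≤ (suc d) = ≤-trans
      (injective⇒∣p∣≤ (ball (suc d)) (λ _ w∈ → encode (reached d w∈))
        (λ _ _ w∈ w′∈ → encode-injective (reached d w∈) (reached d w′∈)))
      (*-monoʳ-≤ (suc Δ) (∣ball∣≤ d))

rainbow⇒n≤ : ∀ {n k Δ} {G : Graph n} (c : EdgeColoring G k) → IsVeryStrongRainbow c → Connected G →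
  (∀ v → degree G v ≤ Δ) → Fin n → n ≤ suc Δ ^ k
rainbow⇒n≤ {k = k} {G = G} c rainbow connected degree≤ r =
  ≤-trans (full⇒n≤∣p∣ (ball k) (λ w → ∈-tabulate⁺ (inBall k) (inBall-k w))) (∣ball∣≤ degree≤ k)
  where
  open Balls G r
  inBall-k : ∀ w → inBall k w ≡ true
  inBall-k w =
    let (l , p , shortest) = shortestPath (connected r w)
    in inBall-mono (rainbow-shortestPath-length≤ c rainbow l p shortest)
                   (inBall-complete l p (proj₁ shortest))

[1+k*t]^k≤[k*[1+t]]^k : ∀ k t → suc (k * t) ^ k ≤ (k * suc t) ^ k
[1+k*t]^k≤[k*[1+t]]^k zero    t = ≤-refl
[1+k*t]^k≤[k*[1+t]]^k (suc k) t =
  ^-monoˡ-≤ (suc k) (subst (suc (suc k * t) ≤_) (≡-sym (*-suc (suc k) t)) (s≤s (m≤n+m _ k)))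

emptyBags⇒¬vertex : ∀ {n} {G : Graph n} (D : TreeDecomposition G) → (∀ x → ∣ bag D x ∣ ≤ 0) → ¬ Fin n
emptyBags⇒¬vertex D bag≤0 v with x , v∈x ← covers-vertices D v
  with () ← inject≤ (position (bag D x) v∈x) (bag≤0 x)

lemma17 : ∀ {n : ℕ} (G : Graph n) (k t : ℕ) → Connected G → vsrc≤ G k → TreewidthBelow G t →
    (∀ (v : Fin n) → degree G v ≤ k * t) × n ≤ (k * t) ^ k
lemma17 {zero}  G k t       _         _              _          = (λ ()) , z≤n
lemma17 {suc n} G k zero    _         _              (D , bag≤) = ⊥-elim (emptyBags⇒¬vertex D bag≤ zero)
lemma17 {suc n} G k (suc t) connected (c , rainbow) (D , bag≤) =
  (λ v → ≤-trans (degree≤ v) (*-monoʳ-≤ k (n≤1+n t))) ,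
  ≤-trans (rainbow⇒n≤ c rainbow connected degree≤ zero) ([1+k*t]^k≤[k*[1+t]]^k k t)
  where
  degree≤ : ∀ v → degree G v ≤ k * t
  degree≤ = DegreeBound.degree≤ c rainbow D bag≤
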